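{- Let $G$ be a graph with $n$ vertices and $m$ edges and $k$ a nonnegative integer such that $G$ has no loops, every edge has multiplicity at most $2$, every vertex has degree at least $3$, and some vertex has degree at least $4$. Assume $2m>3n$ and that $G$ has a feedback vertex set of size at most $k$. Sample a vertex $v$ with probability $(\deg(v)-3)/\sum_{u\in V}(\deg(u)-3)$. Then with probability at least $\min\{\frac12,\frac{m-n-2k}{2m-3n}\}$, the vertex $v$ belongs to a feedback vertex set of $G$ of size at most $k$ (equivalently, $G-v$ has a feedback vertex set of size at most $k-1$).
   Context: Graphs may have parallel edges; $m$ counts edges with multiplicity and degrees count multiplicities. A feedback vertex set of $G=(V,E)$ is a set $F\subseteq V$ such that $G[V\setminus F]$ is a forest (acyclic, where a pair of parallel edges forms a cycle). -}

module Defs where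

open import Data.Nat using (ℕ; zero; suc; _+_; _*_; _∸_)
open import Data.Integer using (ℤ; +_)
open import Data.Fin using (Fin; zero; suc; inject₁; fromℕ; _≟_)
open import Data.Fin.Subset using (Subset; _∈_; _∉_)
open import Data.Fin.Subset.Properties using (_∈?_)
open import Data.Product using (_×_; _,_; proj₁; proj₂; Σ)
open import Data.Sum using (_⊎_)
open import Data.Empty using (⊥)
open import Relation.Nullary using (Dec; yes; no)
open import Relation.Binary.PropositionalEquality using (_≡_)
open import Function.Definitions using (Injective)
open import Data.Rational using (ℚ; 0ℚ; _/_)

-- A finite multigraph on vertex set Fin n with m edges indexed by Fin m.
-- Each edge e has an (arbitrarily oriented) pair of endpoints.
record Multigraph (n m : ℕ) : Set where
  field
    ends : Fin m → Fin n × Fin n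

open Multigraph public

sumF : (k : ℕ) → (Fin k → ℕ) → ℕ
sumF zero    f = 0
sumF (suc k) f = f zero + sumF k (λ i → f (suc i))

ind : ∀ {p} {P : Set p} → Dec P → ℕ
ind (yes _) = 1
ind (no _)  = 0

module _ {n m : ℕ} (G : Multigraph n m) where

  -- degree of v (counting multiplicities; a loop would count twice)
  deg : Fin n → ℕ
  deg v = sumF m (λ e → ind (proj₁ (ends G e) ≟ v) + ind (proj₂ (ends G e) ≟ v))

  mult : Fin n → Fin n → ℕ
  mult u v = sumF m (λ e →
    ind (proj₁ (ends G e) ≟ u) * ind (proj₂ (ends G e) ≟ v)
    + ind (proj₁ (ends G e) ≟ v) * ind (proj₂ (ends G e) ≟ u))

  NoLoops : Set
  NoLoops = ∀ e → proj₁ (ends G e) ≡ proj₂ (ends G e) → ⊥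

  Joins : Fin m → Fin n → Fin n → Set
  Joins e u v = ends G e ≡ (u , v) ⊎ ends G e ≡ (v , u)

  -- A cycle of length suc l (≥ 2): distinct vertices vs 0 … vs l and
  -- distinct edges es 0 … es l, edge es i joining vs i and vs (i+1),
  -- and edge es l joining vs l and vs 0.  (Two parallel edges form a
  -- cycle of length 2.)
  record Cycle (l : ℕ) : Set where
    field
      vs     : Fin (suc l) → Fin n
      es     : Fin (suc l) → Fin m
      vs-inj : Injective _≡_ _≡_ vs
      es-inj : Injective _≡_ _≡_ es
      step   : ∀ (i : Fin l) → Joins (es (inject₁ i)) (vs (inject₁ i)) (vs (suc i))
      close  : Joins (es (fromℕ l)) (vs (fromℕ l)) (vs zero)

  open Cycle public

  -- F is a feedback vertex set: G[V ∖ F] has no cycle, i.e. no cycle of G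
  -- avoids F (edges of a cycle avoiding F lie in G[V ∖ F]).
  IsFVS : Subset n → Set
  IsFVS F = ∀ (l : ℕ) (C : Cycle l) → (∀ i → vs C i ∉ F) → ⊥

-- a / d as a rational number, with the convention a / 0 = 0
-- (only used with positive denominators)
frac : ℤ → ℕ → ℚ
frac a zero    = 0ℚ
frac a (suc d) = a / suc d

-- probability that a vertex sampled with P(v) = w v / Σ_u w u lies in S
probIn : {n : ℕ} → (Fin n → ℕ) → Subset n → ℚ
probIn {n} w S = frac (+ sumF n (λ v → ind (v ∈? S) * w v)) (sumF n w)

module Submission where

-- Let F be a feedback vertex set of G with |F| ≤ k, and take Good = F.  Every
-- v ∈ F lies in a small feedback vertex set (F itself), so it remains to show
--   Σ_{v∈F} (deg v − 3) / Σ_v (deg v − 3)  ≥  (m − n − 2k) / (2m − 3n),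
-- as the minimum with ½ is at most the right-hand side.  The denominator is 2m − 3n by
-- the handshake lemma.  For the numerator, count edges: each edge either lies
-- in the forest G − F, which has at most n − |F| edges, or has an endpoint in
-- F, and there are at most Σ_{v∈F} deg v = Σ_{v∈F} (deg v − 3) + 3|F| of those.
-- Hence m ≤ n + 2|F| + Σ_{v∈F} (deg v − 3), and dividing by 2m − 3n finishes.

open import Defs
open import Data.Nat using (ℕ; zero; suc; _+_; _*_; _≤_; _<_; _∸_; z≤n; s≤s; s≤s⁻¹; _≤?_)
open import Data.Nat.Properties
  using ( ≤-refl; ≤-trans; ≤-reflexive; <-irrefl; ≰⇒>; module ≤-Reasoning
        ; +-comm; +-identityʳ; +-mono-≤; +-monoˡ-≤; +-monoʳ-≤; +-cancelˡ-≤
        ; *-comm; *-identityˡ; *-identityʳ; *-zeroʳ; *-distribˡ-+; *-mono-≤; *-monoʳ-≤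
        ; m≤m+n; m≤n+m; m≤n⇒m≤n+o; m∸n+n≡m; m+n∸n≡m; m+n∸m≡n; +-*-semiring)
open import Data.Nat.Tactic.RingSolver using (solve-∀)
open import Data.Fin using (Fin; zero; suc; toℕ; inject₁; inject≤; fromℕ; punchIn)
open import Data.Fin.Properties
  using ( _≟_; toℕ-injective; toℕ-inject≤; toℕ-inject₁; toℕ-fromℕ; toℕ<n
        ; inject≤-injective; punchInᵢ≢i; any?; pigeonhole)
open import Data.Fin.Relation.Unary.Top using (view; ‵fromℕ; ‵inj₁)
open import Data.Fin.Subset using (Subset; _∈_; ∣_∣; ∁; inside; outside) renaming (_-_ to _∖_)
open import Data.Fin.Subset.Properties
  using ( _∈?_; nonempty?; p─q⊆p; x∈p∧x≢y⇒x∈p-y; x∈p⇒∣p-x∣<∣p∣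
        ; x∉p⇒x∈∁p; x∈∁p⇒x∉p; ∣∁p∣≡n∸∣p∣; ∣p∣≤n)
open import Data.Vec using (_∷_; [])
import Data.Vec.Functional as VF
open import Data.Product using (Σ; _×_; ∃; _,_; proj₁; proj₂)
open import Data.Product.Properties using (,-injectiveˡ; ,-injectiveʳ)
open import Data.Sum using (_⊎_; inj₁; inj₂)
open import Data.Unit using (⊤)
open import Data.Empty using (⊥; ⊥-elim)
open import Function.Definitions using (Injective)
open import Relation.Nullary using (Dec; yes; no; ¬_)
open import Relation.Nullary.Decidable using (_×-dec_; map′)
open import Relation.Binary.PropositionalEquality
open import Algebra.Properties.Semiring.Sum +-*-semiring
  using (sum; sum-cong-≗; ∑-distrib-+; ∑-comm; *-distribˡ-sum; sum-remove)

ind-yes : ∀ {p} {P : Set p} (d : Dec P) → P → ind d ≡ 1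
ind-yes (yes _) _ = refl
ind-yes (no ¬p) p = ⊥-elim (¬p p)

ind-no : ∀ {p} {P : Set p} (d : Dec P) → ¬ P → ind d ≡ 0
ind-no (yes p) ¬p = ⊥-elim (¬p p)
ind-no (no _)  _  = refl

ind≤1 : ∀ {p} {P : Set p} (d : Dec P) → ind d ≤ 1
ind≤1 (yes _) = s≤s z≤n
ind≤1 (no _)  = z≤n

ind-witness : ∀ {p} {P : Set p} (d : Dec P) → 1 ≤ ind d → P
ind-witness (yes p) _ = p

ind-mono : ∀ {p q} {P : Set p} {Q : Set q} → (P → Q) → (d : Dec P) (d' : Dec Q) → ind d ≤ ind d'
ind-mono P⇒Q (yes p) (yes _) = ≤-refl
ind-mono P⇒Q (yes p) (no ¬q) = ⊥-elim (¬q (P⇒Q p))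
ind-mono P⇒Q (no _)  _       = z≤n

ind-map′ : ∀ {p q} {P : Set p} {Q : Set q} {f : P → Q} {g : Q → P} (d : Dec P) → ind (map′ f g d) ≡ ind d
ind-map′ (yes _) = refl
ind-map′ (no _)  = refl

-- Finite sums.  Defs' sumF is definitionally the library's sum over Fin,
-- so its laws are inherited from Algebra.Properties.Semiring.Sum.

sumF≡sum : ∀ k (f : Fin k → ℕ) → sumF k f ≡ sum f
sumF≡sum zero    f = refl
sumF≡sum (suc k) f = cong (_+_ (f zero)) (sumF≡sum k (λ i → f (suc i)))

sumF-cong : ∀ k {f g : Fin k → ℕ} → (∀ i → f i ≡ g i) → sumF k f ≡ sumF k g
sumF-cong zero    eq = refl
sumF-cong (suc k) eq = cong₂ _+_ (eq zero) (sumF-cong k (λ i → eq (suc i)))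

sumF-mono : ∀ k {f g : Fin k → ℕ} → (∀ i → f i ≤ g i) → sumF k f ≤ sumF k g
sumF-mono zero    le = z≤n
sumF-mono (suc k) le = +-mono-≤ (le zero) (sumF-mono k (λ i → le (suc i)))

sumF-const : ∀ k c → sumF k (λ _ → c) ≡ k * c
sumF-const zero    c = refl
sumF-const (suc k) c = cong (_+_ c) (sumF-const k c)

sumF-+ : ∀ k (f g : Fin k → ℕ) → sumF k (λ i → f i + g i) ≡ sumF k f + sumF k g
sumF-+ k f g = begin
  sumF k (λ i → f i + g i) ≡⟨ sumF≡sum k _ ⟩
  sum (λ i → f i + g i)    ≡⟨ ∑-distrib-+ f g ⟩
  sum f + sum g            ≡⟨ sym (cong₂ _+_ (sumF≡sum k f) (sumF≡sum k g)) ⟩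
  sumF k f + sumF k g      ∎
  where open ≡-Reasoning

sumF-*ˡ : ∀ k c (f : Fin k → ℕ) → c * sumF k f ≡ sumF k (λ i → c * f i)
sumF-*ˡ k c f = begin
  c * sumF k f             ≡⟨ cong (c *_) (sumF≡sum k f) ⟩
  c * sum f                ≡⟨ *-distribˡ-sum c f ⟩
  sum (λ i → c * f i)      ≡⟨ sym (sumF≡sum k _) ⟩
  sumF k (λ i → c * f i)   ∎
  where open ≡-Reasoning

sumF-comm : ∀ a b (f : Fin a → Fin b → ℕ) →
  sumF a (λ i → sumF b (f i)) ≡ sumF b (λ j → sumF a (λ i → f i j))
sumF-comm a b f = trans (double a b f) (trans (∑-comm f) (sym (double b a (λ j i → f i j))))
  where
  double : ∀ a b (g : Fin a → Fin b → ℕ) → sumF a (λ i → sumF b (g i)) ≡ sum (λ i → sum (g i))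
  double a b g = trans (sumF≡sum a _) (sum-cong-≗ (λ i → sumF≡sum b (g i)))

sumF-remove : ∀ k (f : Fin (suc k) → ℕ) a → sumF (suc k) f ≡ f a + sumF k (λ j → f (punchIn a j))
sumF-remove k f a = begin
  sumF (suc k) f                        ≡⟨ sumF≡sum (suc k) f ⟩
  sum f                                 ≡⟨ sum-remove f ⟩
  f a + sum (λ j → f (punchIn a j))     ≡⟨ cong (_+_ (f a)) (sym (sumF≡sum k _)) ⟩
  f a + sumF k (λ j → f (punchIn a j))  ∎
  where open ≡-Reasoning

sumF-zero : ∀ k (f : Fin k → ℕ) → (∀ i → f i ≡ 0) → sumF k f ≡ 0
sumF-zero k f vanish = trans (sumF-cong k vanish) (trans (sumF-const k 0) (*-zeroʳ k))

sumF-point : ∀ k (f : Fin k → ℕ) a → (∀ i → i ≢ a → f i ≡ 0) → sumF k f ≡ f a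
sumF-point (suc k) f a vanish = begin
  sumF (suc k) f                        ≡⟨ sumF-remove k f a ⟩
  f a + sumF k (λ j → f (punchIn a j))  ≡⟨ cong (_+_ (f a)) (sumF-zero k _ (λ j → vanish _ (punchInᵢ≢i a j))) ⟩
  f a + 0                               ≡⟨ +-identityʳ (f a) ⟩
  f a                                   ∎
  where open ≡-Reasoning

sumF-positive : ∀ k (f : Fin k → ℕ) → 1 ≤ sumF k f → ∃ λ i → 1 ≤ f i
sumF-positive (suc k) f pos with f zero in eq
... | suc _ = zero , subst (1 ≤_) (sym eq) (s≤s z≤n)
... | zero  with sumF-positive k (λ i → f (suc i)) pos
...   | i , fi = suc i , fi

sumF-another-positive : ∀ k (f : Fin k → ℕ) a → 2 ≤ sumF k f → f a ≤ 1 → ∃ λ i → i ≢ a × 1 ≤ f i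
sumF-another-positive (suc k) f a two fa≤1
  with sumF-positive k (λ j → f (punchIn a j)) rest-positive
  where
  rest-positive : 1 ≤ sumF k (λ j → f (punchIn a j))
  rest-positive = +-cancelˡ-≤ 1 1 _ (begin
    2                                     ≤⟨ two ⟩
    sumF (suc k) f                        ≡⟨ sumF-remove k f a ⟩
    f a + sumF k (λ j → f (punchIn a j))  ≤⟨ +-monoˡ-≤ _ fa≤1 ⟩
    1 + sumF k (λ j → f (punchIn a j))    ∎)
    where open ≤-Reasoning
... | j , fj = punchIn a j , punchInᵢ≢i a j , fj

sumF-select : ∀ k (g : Fin k → ℕ) p → sumF k (λ v → g v * ind (p ≟ v)) ≡ g p
sumF-select k g p = begin
  sumF k (λ v → g v * ind (p ≟ v))  ≡⟨ sumF-point k _ p off-p ⟩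
  g p * ind (p ≟ p)                 ≡⟨ cong (g p *_) (ind-yes (p ≟ p) refl) ⟩
  g p * 1                           ≡⟨ *-identityʳ (g p) ⟩
  g p                               ∎
  where
  open ≡-Reasoning
  off-p : ∀ v → v ≢ p → g v * ind (p ≟ v) ≡ 0
  off-p v v≢p = trans (cong (g v *_) (ind-no (p ≟ v) (λ p≡v → v≢p (sym p≡v)))) (*-zeroʳ (g v))

sumF-count : ∀ {n} (F : Subset n) → sumF n (λ x → ind (x ∈? F)) ≡ ∣ F ∣
sumF-count [] = refl
sumF-count (inside ∷ F)  = cong suc (trans (sumF-cong _ (λ i → ind-map′ (i ∈? F))) (sumF-count F))
sumF-count (outside ∷ F) = trans (sumF-cong _ (λ i → ind-map′ (i ∈? F))) (sumF-count F)

snoc : ∀ {A : Set} {l} → (Fin l → A) → A → Fin (suc l) → A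
snoc {l = zero}  f x zero    = x
snoc {l = suc l} f x zero    = f zero
snoc {l = suc l} f x (suc i) = snoc (λ j → f (suc j)) x i

snoc-inject₁ : ∀ {A : Set} {l} (f : Fin l → A) x i → snoc f x (inject₁ i) ≡ f i
snoc-inject₁ {l = suc l} f x zero    = refl
snoc-inject₁ {l = suc l} f x (suc i) = snoc-inject₁ (λ j → f (suc j)) x i

snoc-last : ∀ {A : Set} l (f : Fin l → A) x → snoc f x (fromℕ l) ≡ x
snoc-last zero    f x = refl
snoc-last (suc l) f x = snoc-last l (λ j → f (suc j)) x

snoc-injective : ∀ {A : Set} {l} {f : Fin l → A} {x} →
  Injective _≡_ _≡_ f → (∀ i → f i ≢ x) → Injective _≡_ _≡_ (snoc f x)
snoc-injective {l = l} {f} {x} f-inj fresh {i} {j} eq with view i | view j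
... | ‵fromℕ    | ‵fromℕ    = refl
... | ‵inj₁ {i = a} _ | ‵inj₁ {i = b} _ =
  cong inject₁ (f-inj (trans (sym (snoc-inject₁ f x a)) (trans eq (snoc-inject₁ f x b))))
... | ‵inj₁ {i = a} _ | ‵fromℕ    =
  ⊥-elim (fresh a (trans (sym (snoc-inject₁ f x a)) (trans eq (snoc-last l f x))))
... | ‵fromℕ    | ‵inj₁ {i = b} _ =
  ⊥-elim (fresh b (trans (sym (snoc-inject₁ f x b)) (trans (sym eq) (snoc-last l f x))))

inject≤-inject₁ : ∀ {l k} (i : Fin l) .(p : suc l ≤ suc k) .(q : l ≤ k) →
  inject≤ (inject₁ i) p ≡ inject₁ (inject≤ i q)
inject≤-inject₁ i p q = toℕ-injective (begin
  toℕ (inject≤ (inject₁ i) p)  ≡⟨ toℕ-inject≤ (inject₁ i) p ⟩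
  toℕ (inject₁ i)              ≡⟨ toℕ-inject₁ i ⟩
  toℕ i                        ≡⟨ sym (toℕ-inject≤ i q) ⟩
  toℕ (inject≤ i q)            ≡⟨ sym (toℕ-inject₁ (inject≤ i q)) ⟩
  toℕ (inject₁ (inject≤ i q))  ∎)
  where open ≡-Reasoning

cons-injective : ∀ {A : Set} {l} {f : Fin l → A} {x} →
  Injective _≡_ _≡_ f → (∀ i → f i ≢ x) → Injective _≡_ _≡_ (x VF.∷ f)
cons-injective f-inj fresh {zero}  {zero}  _    = refl
cons-injective f-inj fresh {zero}  {suc j} same = ⊥-elim (fresh j (sym same))
cons-injective f-inj fresh {suc i} {zero}  same = ⊥-elim (fresh i same)
cons-injective f-inj fresh {suc i} {suc j} same = cong suc (f-inj same)

positive-factors : ∀ a b → 1 ≤ a * b → 1 ≤ a × 1 ≤ b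
positive-factors (suc a) (suc b) _ = s≤s z≤n , s≤s z≤n
positive-factors (suc a) zero    p with () ← ≤-trans p (≤-reflexive (*-zeroʳ (suc a)))

≤-+-scaled : ∀ {a c} b → 1 ≤ c → a ≤ b + a * c
≤-+-scaled {a} {c} b 1≤c = begin
  a        ≡⟨ *-identityʳ a ⟨
  a * 1    ≤⟨ *-monoʳ-≤ a 1≤c ⟩
  a * c    ≤⟨ m≤n+m (a * c) b ⟩
  b + a * c ∎
  where open ≤-Reasoning

regroup : ∀ {f n s} → f ≤ n → n ∸ f + (s + 3 * f) ≡ n + 2 * f + s
regroup {f} {n} {s} f≤n = begin
  n ∸ f + (s + 3 * f)        ≡⟨ shuffle (n ∸ f) s f ⟩
  n ∸ f + f + 2 * f + s      ≡⟨ cong (λ x → x + 2 * f + s) (m∸n+n≡m f≤n) ⟩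
  n + 2 * f + s              ∎
  where
  open ≡-Reasoning
  shuffle : ∀ a s f → a + (s + 3 * f) ≡ a + f + 2 * f + s
  shuffle = solve-∀

module Graph {n m : ℕ} (G : Multigraph n m) where

  src tgt : Fin m → Fin n
  src e = proj₁ (ends G e)
  tgt e = proj₂ (ends G e)

  incidence : Fin n → Fin m → ℕ
  incidence v e = ind (src e ≟ v) + ind (tgt e ≟ v)

  incident : ∀ v e → 1 ≤ incidence v e → src e ≡ v ⊎ tgt e ≡ v
  incident v e pos with src e ≟ v
  ... | yes p = inj₁ p
  ... | no _  = inj₂ (ind-witness (tgt e ≟ v) pos)

  incidence-nonloop : ∀ v e → src e ≢ tgt e → incidence v e ≤ 1
  incidence-nonloop v e nonloop with src e ≟ v | tgt e ≟ v
  ... | yes p | yes q = ⊥-elim (nonloop (trans p (sym q)))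
  ... | yes _ | no _  = ≤-refl
  ... | no _  | yes _ = ≤-refl
  ... | no _  | no _  = z≤n

  degree-sum : ∀ (g : Fin n → ℕ) → sumF n (λ v → g v * deg G v) ≡ sumF m (λ e → g (src e) + g (tgt e))
  degree-sum g = begin
    sumF n (λ v → g v * deg G v)
      ≡⟨ sumF-cong n (λ v → sumF-*ˡ m (g v) (λ e → incidence v e)) ⟩
    sumF n (λ v → sumF m (λ e → g v * incidence v e))
      ≡⟨ sumF-comm n m _ ⟩
    sumF m (λ e → sumF n (λ v → g v * incidence v e))
      ≡⟨ sumF-cong m (λ e → trans (sumF-cong n (λ v → *-distribˡ-+ (g v) _ _)) (sumF-+ n _ _)) ⟩
    sumF m (λ e → sumF n (λ v → g v * ind (src e ≟ v)) + sumF n (λ v → g v * ind (tgt e ≟ v)))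
      ≡⟨ sumF-cong m (λ e → cong₂ _+_ (sumF-select n g (src e)) (sumF-select n g (tgt e))) ⟩
    sumF m (λ e → g (src e) + g (tgt e))
      ∎
    where open ≡-Reasoning

  handshake : sumF n (deg G) ≡ 2 * m
  handshake = begin
    sumF n (deg G)                    ≡⟨ sumF-cong n (λ v → sym (*-identityˡ (deg G v))) ⟩
    sumF n (λ v → 1 * deg G v)        ≡⟨ degree-sum (λ _ → 1) ⟩
    sumF m (λ _ → 2)                  ≡⟨ sumF-const m 2 ⟩
    m * 2                             ≡⟨ *-comm m 2 ⟩
    2 * m                             ∎
    where open ≡-Reasoning

  excess-sum : (∀ v → 3 ≤ deg G v) → sumF n (λ v → deg G v ∸ 3) ≡ 2 * m ∸ 3 * n
  excess-sum deg≥3 = begin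
    sumF n (λ v → deg G v ∸ 3)                             ≡⟨ sym (m+n∸n≡m _ (3 * n)) ⟩
    sumF n (λ v → deg G v ∸ 3) + 3 * n ∸ 3 * n             ≡⟨ cong (λ x → sumF n (λ v → deg G v ∸ 3) + x ∸ 3 * n)
                                                                (trans (*-comm 3 n) (sym (sumF-const n 3))) ⟩
    sumF n (λ v → deg G v ∸ 3) + sumF n (λ _ → 3) ∸ 3 * n  ≡⟨ cong (_∸ 3 * n) (sym (sumF-+ n _ _)) ⟩
    sumF n (λ v → deg G v ∸ 3 + 3) ∸ 3 * n                 ≡⟨ cong (_∸ 3 * n) (sumF-cong n (λ v → m∸n+n≡m (deg≥3 v))) ⟩
    sumF n (deg G) ∸ 3 * n                                 ≡⟨ cong (_∸ 3 * n) handshake ⟩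
    2 * m ∸ 3 * n                                          ∎
    where open ≡-Reasoning

  Joins-sym : ∀ {e a b} → Joins G e a b → Joins G e b a
  Joins-sym (inj₁ p) = inj₂ p
  Joins-sym (inj₂ p) = inj₁ p

  Joins-ends : ∀ {e a b c d} → Joins G e a b → Joins G e c d → (a ≡ c × b ≡ d) ⊎ (a ≡ d × b ≡ c)
  Joins-ends (inj₁ p) (inj₁ q) = inj₁ (,-injectiveˡ (trans (sym p) q) , ,-injectiveʳ (trans (sym p) q))
  Joins-ends (inj₁ p) (inj₂ q) = inj₂ (,-injectiveˡ (trans (sym p) q) , ,-injectiveʳ (trans (sym p) q))
  Joins-ends (inj₂ p) (inj₁ q) = inj₂ (,-injectiveʳ (trans (sym p) q) , ,-injectiveˡ (trans (sym p) q))
  Joins-ends (inj₂ p) (inj₂ q) = inj₁ (,-injectiveʳ (trans (sym p) q) , ,-injectiveˡ (trans (sym p) q))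

  Joins-loop : ∀ {e a b} → Joins G e a b → src e ≡ tgt e → a ≡ b
  Joins-loop (inj₁ p) loop = trans (sym (,-injectiveˡ p)) (trans loop (,-injectiveʳ p))
  Joins-loop (inj₂ p) loop = trans (sym (,-injectiveʳ p)) (trans (sym loop) (,-injectiveˡ p))

  Internal : Subset n → Fin m → Set
  Internal A e = src e ∈ A × tgt e ∈ A

  internal? : ∀ A e → Dec (Internal A e)
  internal? A e = (src e ∈? A) ×-dec (tgt e ∈? A)

  internal : Subset n → Fin m → ℕ
  internal A e = ind (internal? A e)

  internal≤1 : ∀ A e → internal A e ≤ 1
  internal≤1 A e = ind≤1 (internal? A e)

  innerDeg : Subset n → Fin n → ℕ
  innerDeg A v = sumF m (λ e → internal A e * incidence v e)

  innerEdges : Subset n → ℕ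
  innerEdges A = sumF m (internal A)

  neighbour : ∀ {A} v e → 1 ≤ internal A e * incidence v e → Σ (Fin n) λ u → Joins G e v u × u ∈ A
  neighbour {A} v e pos with positive-factors (internal A e) _ pos
  ... | inner , inc with ind-witness (internal? A e) inner | incident v e inc
  ...   | _ , tgt∈A | inj₁ refl = tgt e , inj₁ refl , tgt∈A
  ...   | src∈A , _ | inj₂ refl = src e , inj₂ refl , src∈A

  Forest : Subset n → Set
  Forest A = ∀ l (C : Cycle G l) → (∀ i → vs C i ∈ A) → ⊥

  -- a simple path of length k in G[A], listed from its head vertex 0
  record Path (A : Subset n) (k : ℕ) : Set where
    field
      vertex     : Fin (suc k) → Fin n
      edge       : Fin k → Fin m
      vertex-inj : Injective _≡_ _≡_ vertex
      edge-inj   : Injective _≡_ _≡_ edge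
      link       : ∀ i → Joins G (edge i) (vertex (inject₁ i)) (vertex (suc i))
      inA        : ∀ i → vertex i ∈ A

  open Path

  module _ {A : Subset n} where

    path-short : ∀ {k} → Path A k → n ≤ k → ⊥
    path-short π n≤k with pigeonhole (s≤s n≤k) (vertex π)
    ... | i , j , i<j , same = <-irrefl (cong toℕ (vertex-inj π same)) i<j

    first-nonloop : ∀ {k} (π : Path A (suc k)) → src (edge π zero) ≢ tgt (edge π zero)
    first-nonloop π loop with vertex-inj π (Joins-loop (link π zero) loop)
    ... | ()

    prefix : ∀ {k} → Path A k → (j : Fin (suc k)) → Path A (toℕ j)
    prefix {k} π j = record
      { vertex     = λ i → vertex π (inject≤ i j<)
      ; edge       = λ i → edge π (inject≤ i j≤)
      ; vertex-inj = λ same → inject≤-injective _ _ _ _ (vertex-inj π same)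
      ; edge-inj   = λ same → inject≤-injective _ _ _ _ (edge-inj π same)
      ; link       = prefix-link
      ; inA        = λ i → inA π _
      }
      where
      j< : suc (toℕ j) ≤ suc k
      j< = toℕ<n j
      j≤ : toℕ j ≤ k
      j≤ = s≤s⁻¹ j<
      prefix-link : ∀ i → Joins G (edge π (inject≤ i j≤)) (vertex π (inject≤ (inject₁ i) j<))
                                  (vertex π (suc (inject≤ i j≤)))
      prefix-link i rewrite inject≤-inject₁ i j< j≤ = link π (inject≤ i j≤)

    prefix-last : ∀ {k} (π : Path A k) j → vertex (prefix π j) (fromℕ (toℕ j)) ≡ vertex π j
    prefix-last π j = cong (vertex π) (toℕ-injective (trans (toℕ-inject≤ _ _) (toℕ-fromℕ (toℕ j))))

    close-cycle : ∀ {l} (π : Path A l) e → Joins G e (vertex π (fromℕ l)) (vertex π zero) →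
      (∀ i → edge π i ≢ e) → Cycle G l
    close-cycle {l} π e J fresh = record
      { vs     = vertex π
      ; es     = snoc (edge π) e
      ; vs-inj = vertex-inj π
      ; es-inj = snoc-injective (edge-inj π) fresh
      ; step   = λ i → subst (λ x → Joins G x _ _) (sym (snoc-inject₁ (edge π) e i)) (link π i)
      ; close  = subst (λ x → Joins G x _ _) (sym (snoc-last l (edge π) e)) J
      }

    extend : ∀ {k} (π : Path A k) e u → Joins G e u (vertex π zero) → u ∈ A →
      (∀ j → vertex π j ≢ u) → (∀ i → edge π i ≢ e) → Path A (suc k)
    extend π e u J u∈A u-new e-new = record
      { vertex     = u VF.∷ vertex π
      ; edge       = e VF.∷ edge π
      ; vertex-inj = cons-injective (vertex-inj π) u-new
      ; edge-inj   = cons-injective (edge-inj π) e-new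
      ; link       = λ { zero → J ; (suc i) → link π i }
      ; inA        = λ { zero → u∈A ; (suc i) → inA π i }
      }

    AvoidsFirst : ∀ {k} → Path A k → Fin m → Set
    AvoidsFirst {zero}  π e = ⊤
    AvoidsFirst {suc k} π e = edge π zero ≢ e

    avoids-path : ∀ {k e u} (π : Path A k) → AvoidsFirst π e → Joins G e (vertex π zero) u →
      ∀ i → edge π i ≢ e
    avoids-path π avoid J i refl with Joins-ends (link π i) J
    ... | inj₁ (at-head , _) = not-first i avoid (vertex-inj π at-head)
      where
      not-first : ∀ {k} {π : Path A k} (i : Fin k) → AvoidsFirst π (edge π i) → inject₁ i ≢ zero
      not-first zero    avoid _ = avoid refl
      not-first (suc i) _     ()
    ... | inj₂ (_ , back-to-head) with vertex-inj π back-to-head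
    ...   | ()

    single-vertex : ∀ {v} → v ∈ A → Path A 0
    single-vertex {v} v∈A = record
      { vertex = λ _ → v ; edge = λ () ; vertex-inj = λ {i} {j} _ → Fin1-unique i j
      ; edge-inj = λ { {()} } ; link = λ () ; inA = λ _ → v∈A }
      where
      Fin1-unique : ∀ (i j : Fin 1) → i ≡ j
      Fin1-unique zero zero = refl

    -- If G[A] is a forest in which every vertex has degree at least 2, every
    -- path extends by one more edge; since paths are short, A must be empty.
    module NoLeaf (forest : Forest A) (deg≥2 : ∀ v → v ∈ A → 2 ≤ innerDeg A v) where

      next-edge : ∀ {k} (π : Path A k) →
        Σ (Fin m) λ e → 1 ≤ internal A e * incidence (vertex π zero) e × AvoidsFirst π e
      next-edge {zero} π with sumF-positive m _ (≤-trans (s≤s z≤n) (deg≥2 _ (inA π zero)))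
      ... | e , pos = e , pos , _
      next-edge {suc k} π with sumF-another-positive m _ (edge π zero) (deg≥2 _ (inA π zero)) first-weight
        where
        first-weight : internal A (edge π zero) * incidence (vertex π zero) (edge π zero) ≤ 1
        first-weight = *-mono-≤ (internal≤1 A (edge π zero))
                                (incidence-nonloop (vertex π zero) (edge π zero) (first-nonloop π))
      ... | e , e≢first , pos = e , pos , (λ first≡e → e≢first (sym first≡e))

      -- follow the next edge: it either closes a cycle (impossible) or extends π
      grow : ∀ {k} → Path A k → Path A (suc k)
      grow π with next-edge π
      ... | e , pos , avoid with neighbour (vertex π zero) e pos
      ...   | u , J , u∈A with any? (λ j → vertex π j ≟ u)
      ...     | no u-new =
        extend π e u (Joins-sym J) u∈A (λ j same → u-new (j , same)) (avoids-path π avoid J)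
      ...     | yes (j , same) = ⊥-elim (forest _ cycle (inA (prefix π j)))
        where
        closing : Joins G e (vertex (prefix π j) (fromℕ (toℕ j))) (vertex π zero)
        closing rewrite prefix-last π j | same = Joins-sym J
        cycle : Cycle G (toℕ j)
        cycle = close-cycle (prefix π j) e closing (λ i → avoids-path π avoid J _)

      path-of-length : ∀ {v} → v ∈ A → ∀ k → Path A k
      path-of-length v∈A zero    = single-vertex v∈A
      path-of-length v∈A (suc k) = grow (path-of-length v∈A k)

      A-empty : ∀ v → v ∈ A → ⊥
      A-empty v v∈A = path-short (path-of-length v∈A n) ≤-refl

  leaf : ∀ {A v} → Forest A → v ∈ A → ∃ λ w → w ∈ A × innerDeg A w ≤ 1
  leaf {A} {v} forest v∈A with any? (λ w → (w ∈? A) ×-dec (innerDeg A w ≤? 1))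
  ... | yes (w , w∈A , small) = w , w∈A , small
  ... | no no-leaf = ⊥-elim (NoLeaf.A-empty forest deg≥2 v v∈A)
    where
    deg≥2 : ∀ w → w ∈ A → 2 ≤ innerDeg A w
    deg≥2 w w∈A = ≰⇒> (λ small → no-leaf (w , w∈A , small))

  internal-remove : ∀ A v e → internal A e ≤ internal (A ∖ v) e + internal A e * incidence v e
  internal-remove A v e with src e ≟ v | tgt e ≟ v
  ... | yes _ | _     = ≤-+-scaled _ (s≤s z≤n)
  ... | no _  | yes _ = ≤-+-scaled _ ≤-refl
  ... | no s≢v | no t≢v = m≤n⇒m≤n+o _ (ind-mono survives (internal? A e) (internal? (A ∖ v) e))
    where
    survives : Internal A e → Internal (A ∖ v) e
    survives (s∈A , t∈A) = x∈p∧x≢y⇒x∈p-y s∈A s≢v , x∈p∧x≢y⇒x∈p-y t∈A t≢v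

  innerEdges-remove : ∀ A v → innerEdges A ≤ innerEdges (A ∖ v) + innerDeg A v
  innerEdges-remove A v = ≤-trans (sumF-mono m (internal-remove A v)) (≤-reflexive (sumF-+ m _ _))

  Forest-remove : ∀ {A} v → Forest A → Forest (A ∖ v)
  Forest-remove {A} v forest l C in-A-v = forest l C (λ i → p─q⊆p A _ (in-A-v i))

  -- a forest has at most as many edges as vertices: delete a leaf and recurse
  -- (the bound s on the number of vertices drives the recursion)
  forest-edges-bounded : ∀ s {A} → ∣ A ∣ ≤ s → Forest A → innerEdges A ≤ ∣ A ∣
  forest-edges-bounded s {A} size forest with nonempty? A
  ... | no empty = ≤-trans (≤-reflexive (sumF-zero m _ no-edges)) z≤n
    where
    no-edges : ∀ e → internal A e ≡ 0
    no-edges e = ind-no (internal? A e) (λ (src∈A , _) → empty (src e , src∈A))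
  ... | yes (v , v∈A) with leaf forest v∈A
  ...   | w , w∈A , small with s | ≤-trans (x∈p⇒∣p-x∣<∣p∣ w∈A) size
  ...     | suc s′ | fewer = begin
    innerEdges A                       ≤⟨ innerEdges-remove A w ⟩
    innerEdges (A ∖ w) + innerDeg A w  ≤⟨ +-mono-≤ rest small ⟩
    ∣ A ∖ w ∣ + 1                      ≡⟨ +-comm _ 1 ⟩
    suc ∣ A ∖ w ∣                      ≤⟨ x∈p⇒∣p-x∣<∣p∣ w∈A ⟩
    ∣ A ∣                              ∎
    where
    open ≤-Reasoning
    rest : innerEdges (A ∖ w) ≤ ∣ A ∖ w ∣
    rest = forest-edges-bounded s′ (s≤s⁻¹ fewer) (Forest-remove w forest)

  forest-edges : ∀ {A} → Forest A → innerEdges A ≤ ∣ A ∣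
  forest-edges {A} = forest-edges-bounded ∣ A ∣ ≤-refl

  FVS⇒Forest : ∀ {F} → IsFVS G F → Forest (∁ F)
  FVS⇒Forest fvs l C in-∁F = fvs l C (λ i → x∈∁p⇒x∉p (in-∁F i))

  member : Subset n → Fin n → ℕ
  member F v = ind (v ∈? F)

  edge-cover : ∀ F e → 1 ≤ internal (∁ F) e + (member F (src e) + member F (tgt e))
  edge-cover F e with src e ∈? F | tgt e ∈? F
  ... | yes _    | _        = ≤-trans (s≤s z≤n) (m≤n+m _ _)
  ... | no _     | yes _    = m≤n+m 1 _
  ... | no src∉F | no tgt∉F = ≤-trans (≤-reflexive (sym outside-F)) (m≤m+n _ _)
    where
    outside-F : internal (∁ F) e ≡ 1
    outside-F = ind-yes (internal? (∁ F) e) (x∉p⇒x∈∁p src∉F , x∉p⇒x∈∁p tgt∉F)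

  excess : Subset n → ℕ
  excess F = sumF n (λ v → member F v * (deg G v ∸ 3))

  degree-sum-in : ∀ F → (∀ v → 3 ≤ deg G v) →
    sumF n (λ v → member F v * deg G v) ≡ excess F + 3 * ∣ F ∣
  degree-sum-in F deg≥3 = begin
    sumF n (λ v → inF v * deg G v)                          ≡⟨ sumF-cong n split ⟩
    sumF n (λ v → inF v * (deg G v ∸ 3) + 3 * inF v)        ≡⟨ sumF-+ n _ _ ⟩
    excess F + sumF n (λ v → 3 * inF v)                     ≡⟨ cong (_+_ (excess F)) (sym (sumF-*ˡ n 3 inF)) ⟩
    excess F + 3 * sumF n inF                               ≡⟨ cong (λ x → excess F + 3 * x) (sumF-count F) ⟩
    excess F + 3 * ∣ F ∣                                    ∎
    where
    open ≡-Reasoning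
    inF : Fin n → ℕ
    inF = member F
    split : ∀ v → inF v * deg G v ≡ inF v * (deg G v ∸ 3) + 3 * inF v
    split v = begin
      inF v * deg G v                    ≡⟨ cong (inF v *_) (sym (m∸n+n≡m (deg≥3 v))) ⟩
      inF v * (deg G v ∸ 3 + 3)          ≡⟨ *-distribˡ-+ (inF v) _ 3 ⟩
      inF v * (deg G v ∸ 3) + inF v * 3  ≡⟨ cong (_+_ (inF v * (deg G v ∸ 3))) (*-comm (inF v) 3) ⟩
      inF v * (deg G v ∸ 3) + 3 * inF v  ∎

  edge-bound : ∀ F → IsFVS G F → (∀ v → 3 ≤ deg G v) → m ≤ n + 2 * ∣ F ∣ + excess F
  edge-bound F fvs deg≥3 = begin
    m                                                    ≡⟨ sym (trans (sumF-const m 1) (*-identityʳ m)) ⟩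
    sumF m (λ _ → 1)                                     ≤⟨ sumF-mono m (edge-cover F) ⟩
    sumF m (λ e → internal (∁ F) e + (inF (src e) + inF (tgt e)))
                                                         ≡⟨ sumF-+ m _ _ ⟩
    innerEdges (∁ F) + sumF m (λ e → inF (src e) + inF (tgt e))
                                                         ≤⟨ +-monoˡ-≤ _ (forest-edges (FVS⇒Forest fvs)) ⟩
    ∣ ∁ F ∣ + sumF m (λ e → inF (src e) + inF (tgt e))   ≡⟨ cong₂ _+_ (∣∁p∣≡n∸∣p∣ F) (sym (degree-sum inF)) ⟩
    n ∸ ∣ F ∣ + sumF n (λ v → inF v * deg G v)           ≡⟨ cong (_+_ (n ∸ ∣ F ∣)) (degree-sum-in F deg≥3) ⟩
    n ∸ ∣ F ∣ + (excess F + 3 * ∣ F ∣)                   ≡⟨ regroup (∣p∣≤n F) ⟩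
    n + 2 * ∣ F ∣ + excess F                             ∎
    where
    open ≤-Reasoning
    inF : Fin n → ℕ
    inF = member F

-- Integer and rational notation is opened only from here on: its prefix +_
-- would make sums such as  x + 1  ambiguous in the sections above.
open import Data.Integer using (ℤ; +_; _-_)
import Data.Integer as ℤ
import Data.Integer.Properties as ℤP
open import Data.Rational using (½; _⊓_) renaming (_≤_ to _≤ℚ_)
import Data.Rational.Properties as ℚP
import Data.Rational.Unnormalised as ℚᵘ
import Data.Rational.Unnormalised.Properties as ℚᵘP

frac-mono : ∀ {a b : ℤ} d → a ℤ.≤ b → frac a d ≤ℚ frac b d
frac-mono zero    _   = ℚP.≤-refl
frac-mono {a} {b} (suc d) a≤b = ℚP.toℚᵘ-cancel-≤
  (ℚᵘP.≤-respˡ-≃ (ℚᵘP.≃-sym (ℚP.toℚᵘ-fromℚᵘ (ℚᵘ.mkℚᵘ a d)))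
    (ℚᵘP.≤-respʳ-≃ (ℚᵘP.≃-sym (ℚP.toℚᵘ-fromℚᵘ (ℚᵘ.mkℚᵘ b d)))
      (ℚᵘ.*≤* (ℤP.*-monoʳ-≤-nonNeg (+ suc d) a≤b))))

subtract-bound : ∀ m a b s → m ≤ a + b + s → + m - + a - + b ℤ.≤ + s
subtract-bound m a b s m≤ = begin
  + m - + a - + b              ≡⟨ ℤP.+-assoc (+ m) (ℤ.- + a) (ℤ.- + b) ⟩
  + m ℤ.+ (ℤ.- + a ℤ.+ ℤ.- + b) ≡⟨ cong (ℤ._+_ (+ m)) (sym (ℤP.neg-distrib-+ (+ a) (+ b))) ⟩
  + m - (+ a ℤ.+ + b)           ≡⟨ ℤP.[+m]-[+n]≡m⊖n m (a + b) ⟩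
  m ℤ.⊖ (a + b)                 ≤⟨ ℤP.⊖-monoˡ-≤ (a + b) m≤ ⟩
  (a + b + s) ℤ.⊖ (a + b)       ≡⟨ ℤP.≤-⊖ (m≤m+n (a + b) s) ⟩
  + (a + b + s ∸ (a + b))       ≡⟨ cong +_ (m+n∸m≡n (a + b) s) ⟩
  + s                           ∎
  where open ℤP.≤-Reasoning

lemma6 : ∀ {n m : ℕ} (G : Multigraph n m) (k : ℕ)
    → NoLoops G
    → (∀ u v → mult G u v ≤ 2)
    → (∀ v → 3 ≤ deg G v)
    → ∃ (λ v → 4 ≤ deg G v)
    → 3 * n < 2 * m
    → Σ (Subset n) (λ F → ∣ F ∣ ≤ k × IsFVS G F)
    → Σ (Subset n) (λ Good →
         (∀ v → v ∈ Good → Σ (Subset n) (λ F → ∣ F ∣ ≤ k × IsFVS G F × v ∈ F))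
         × (½ ⊓ frac (+ m - + n - + (2 * k)) (2 * m ∸ 3 * n)
              ≤ℚ probIn (λ v → deg G v ∸ 3) Good))
-- Good is the given feedback vertex set F itself.
lemma6 {n} {m} G k _ _ deg≥3 _ _ (F , F≤k , fvs) =
  F , (λ v v∈F → F , F≤k , fvs , v∈F) , ℚP.≤-trans (ℚP.p⊓q≤q ½ _) F-likely
  where
  open Graph G
  F-heavy : m ≤ n + 2 * k + excess F
  F-heavy = ≤-trans (edge-bound F fvs deg≥3) (+-monoˡ-≤ _ (+-monoʳ-≤ n (*-monoʳ-≤ 2 F≤k)))
  F-likely : frac (+ m - + n - + (2 * k)) (2 * m ∸ 3 * n) ≤ℚ probIn (λ v → deg G v ∸ 3) F
  F-likely = subst (λ d → frac (+ m - + n - + (2 * k)) (2 * m ∸ 3 * n) ≤ℚ frac (+ excess F) d)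
    (sym (excess-sum deg≥3))
    (frac-mono (2 * m ∸ 3 * n) (subtract-bound m n (2 * k) (excess F) F-heavy))
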